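{- Let $t$ be a closed term of type $\rho^*$ of the star combinatory calculus. Then there are closed terms $q_1,\ldots,q_n$ ($n\ge 1$) of type $\rho$ such that $$\mathrm{IL}^{\omega}_* \vdash w\in t \leftrightarrow (w=q_1 \lor \ldots \lor w=q_n),$$ where $w$ is a variable of type $\rho$.
   Context: Fix a first-order language $\mathcal{L}$ containing at least one constant symbol. Types are generated by: $G$ (ground type) is a type; if $\sigma,\tau$ are types then $\sigma\to\tau$ and $\sigma^*$ are types ($\to$ associates to the right). Constants: each $n$-ary function symbol $f$ of $\mathcal{L}$ is a constant of type $G\to\cdots\to G\to G$ ($n$ arrows); combinators $\Pi_{\sigma,\tau}:\sigma\to\tau\to\sigma$ and $\Sigma_{\rho,\sigma,\tau}:(\rho\to\sigma\to\tau)\to(\rho\to\sigma)\to\rho\to\tau$; star constants $\mathfrak{s}_\sigma:\sigma\to\sigma^*$, $\cup_\sigma:\sigma^*\to\sigma^*\to\sigma^*$, $\bigcup_{\sigma,\tau}:\sigma^*\to(\sigma\to\tau^*)\to\tau^*$. Terms are constants, variables (countably many of each type), and applications $tq$ ($t:\sigma\to\tau$, $q:\sigma$, giving type $\tau$). Atomic formulas: $\bot$, $t=_\rho q$, $t\in_\rho q$ (with $t:\rho$, $q:\rho^*$), and $R(t_1,\dots,t_n)$ for relation symbols $R$ of $\mathcal{L}$ and terms $t_i:G$. Formulas are built with $\lor,\land,\to,\forall x,\exists x$ and bounded quantifiers $\forall x\in t$, $\exists x\in t$ ($t:\rho^*$ not containing $x:\rho$). The theory $\mathrm{IL}^{\omega}_*$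 is intuitionistic predicate logic in all these types together with: equality axioms $x=_\rho x$ and $x=_\rho y\land A\to A'$ ($A$ atomic, $A'$ obtained by replacing some occurrences of $x$ by $y$); $\forall x\in t\,A(x)\leftrightarrow\forall x(x\in t\to A(x))$ and $\exists x\in t\,A(x)\leftrightarrow\exists x(x\in t\land A(x))$; $\Sigma xyz=xz(yz)$, $\Pi xy=x$; and the star axioms $w\in\mathfrak{s}x\leftrightarrow w=x$, $w\in\cup xy\leftrightarrow w\in x\lor w\in y$, $z\in x\land w\in yz\to w\in\bigcup xy$, $\bigcup(\mathfrak{s}x)y=yx$, $\bigcup(\cup xy)z=\cup(\bigcup xz)(\bigcup yz)$. -}

module Defs where

open import Data.Nat using (ℕ; zero; suc)
open import Data.List using (List; []; _∷_; map)
open import Data.List.Membership.Propositional using () renaming (_∈_ to _∈ᴸ_)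
open import Data.Vec using (Vec) renaming (map to vmap; _∷_ to _∷ᵛ_; [] to []ᵛ)
open import Relation.Binary.PropositionalEquality using (_≡_)

record Language : Set₁ where
  field
    Fun      : Set
    arity    : Fun → ℕ
    Rel      : Set
    relArity : Rel → ℕ
    const    : Fun
    const-0  : arity const ≡ 0

infixr 30 _⇒_
infix 40 _*
data Ty : Set where
  G   : Ty
  _⇒_ : Ty → Ty → Ty
  _*  : Ty → Ty

arrG : ℕ → Ty
arrG zero    = G
arrG (suc n) = G ⇒ arrG n

Ctx : Set
Ctx = List Ty

infix 4 _∋_
data _∋_ : Ctx → Ty → Set where
  ze : ∀ {Γ σ} → (σ ∷ Γ) ∋ σ
  su : ∀ {Γ σ τ} → Γ ∋ σ → (τ ∷ Γ) ∋ σ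

module _ (L : Language) where
  open Language L

  infixl 40 _·_
  data Tm (Γ : Ctx) : Ty → Set where
    var  : ∀ {σ} → Γ ∋ σ → Tm Γ σ
    fun  : (f : Fun) → Tm Γ (arrG (arity f))
    Πc   : ∀ {σ τ} → Tm Γ (σ ⇒ τ ⇒ σ)
    Σc   : ∀ {ρ σ τ} → Tm Γ ((ρ ⇒ σ ⇒ τ) ⇒ (ρ ⇒ σ) ⇒ ρ ⇒ τ)
    𝔰c   : ∀ {σ} → Tm Γ (σ ⇒ σ *)
    ∪c   : ∀ {σ} → Tm Γ (σ * ⇒ σ * ⇒ σ *)
    ⋃c   : ∀ {σ τ} → Tm Γ (σ * ⇒ (σ ⇒ τ *) ⇒ τ *)
    _·_  : ∀ {σ τ} → Tm Γ (σ ⇒ τ) → Tm Γ σ → Tm Γ τ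

  infixr 20 _⇒'_
  infixr 22 _∨'_
  infixr 24 _∧'_
  infix  26 _≐_ _∈'_
  data Fm (Γ : Ctx) : Set where
    ⊥'    : Fm Γ
    _≐_   : ∀ {ρ} → Tm Γ ρ → Tm Γ ρ → Fm Γ
    _∈'_  : ∀ {ρ} → Tm Γ ρ → Tm Γ (ρ *) → Fm Γ
    rel   : (R : Rel) → Vec (Tm Γ G) (relArity R) → Fm Γ
    _∧'_  : Fm Γ → Fm Γ → Fm Γ
    _∨'_  : Fm Γ → Fm Γ → Fm Γ
    _⇒'_  : Fm Γ → Fm Γ → Fm Γ
    ∀'    : ∀ {σ} → Fm (σ ∷ Γ) → Fm Γ
    ∃'    : ∀ {σ} → Fm (σ ∷ Γ) → Fm Γ
    -- bounded quantifiers ∀x∈t A, ∃x∈t A (t cannot contain the bound x)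
    ∀∈    : ∀ {ρ} → Tm Γ (ρ *) → Fm (ρ ∷ Γ) → Fm Γ
    ∃∈    : ∀ {ρ} → Tm Γ (ρ *) → Fm (ρ ∷ Γ) → Fm Γ

module _ {L : Language} where
  open Language L

  infix 18 _⇔'_
  _⇔'_ : ∀ {Γ} → Fm L Γ → Fm L Γ → Fm L Γ
  A ⇔' B = (A ⇒' B) ∧' (B ⇒' A)

module _ (L : Language) where
  open Language L

  data Atomic {Γ : Ctx} : Fm L Γ → Set where
    at-⊥   : Atomic ⊥'
    at-eq  : ∀ {ρ} (s t : Tm L Γ ρ) → Atomic (s ≐ t)
    at-mem : ∀ {ρ} (s : Tm L Γ ρ) (t : Tm L Γ (ρ *)) → Atomic (s ∈' t)
    at-rel : ∀ R ts → Atomic (rel R ts)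

module _ {L : Language} where
  open Language L

  Ren : Ctx → Ctx → Set
  Ren Γ Δ = ∀ {σ} → Γ ∋ σ → Δ ∋ σ

  liftR : ∀ {Γ Δ τ} → Ren Γ Δ → Ren (τ ∷ Γ) (τ ∷ Δ)
  liftR r ze     = ze
  liftR r (su x) = su (r x)

  renT : ∀ {Γ Δ σ} → Ren Γ Δ → Tm L Γ σ → Tm L Δ σ
  renT r (var x) = var (r x)
  renT r (fun f) = fun f
  renT r Πc      = Πc
  renT r Σc      = Σc
  renT r 𝔰c      = 𝔰c
  renT r ∪c      = ∪c
  renT r ⋃c      = ⋃c
  renT r (s · t) = renT r s · renT r t

  renF : ∀ {Γ Δ} → Ren Γ Δ → Fm L Γ → Fm L Δ
  renF r ⊥'        = ⊥'
  renF r (s ≐ t)   = renT r s ≐ renT r t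
  renF r (s ∈' t)  = renT r s ∈' renT r t
  renF r (rel R ts) = rel R (vmap (renT r) ts)
  renF r (A ∧' B)  = renF r A ∧' renF r B
  renF r (A ∨' B)  = renF r A ∨' renF r B
  renF r (A ⇒' B)  = renF r A ⇒' renF r B
  renF r (∀' A)    = ∀' (renF (liftR r) A)
  renF r (∃' A)    = ∃' (renF (liftR r) A)
  renF r (∀∈ t A)  = ∀∈ (renT r t) (renF (liftR r) A)
  renF r (∃∈ t A)  = ∃∈ (renT r t) (renF (liftR r) A)

  wkT : ∀ {Γ σ τ} → Tm L Γ σ → Tm L (τ ∷ Γ) σ
  wkT = renT su

  wkF : ∀ {Γ τ} → Fm L Γ → Fm L (τ ∷ Γ)
  wkF = renF su

  Sub : Ctx → Ctx → Set
  Sub Γ Δ = ∀ {σ} → Γ ∋ σ → Tm L Δ σ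

  liftS : ∀ {Γ Δ τ} → Sub Γ Δ → Sub (τ ∷ Γ) (τ ∷ Δ)
  liftS s ze     = var ze
  liftS s (su x) = wkT (s x)

  subT : ∀ {Γ Δ σ} → Sub Γ Δ → Tm L Γ σ → Tm L Δ σ
  subT s (var x) = s x
  subT s (fun f) = fun f
  subT s Πc      = Πc
  subT s Σc      = Σc
  subT s 𝔰c      = 𝔰c
  subT s ∪c      = ∪c
  subT s ⋃c      = ⋃c
  subT s (a · b) = subT s a · subT s b

  subF : ∀ {Γ Δ} → Sub Γ Δ → Fm L Γ → Fm L Δ
  subF s ⊥'         = ⊥'
  subF s (a ≐ b)    = subT s a ≐ subT s b
  subF s (a ∈' b)   = subT s a ∈' subT s b
  subF s (rel R ts) = rel R (vmap (subT s) ts)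
  subF s (A ∧' B)   = subF s A ∧' subF s B
  subF s (A ∨' B)   = subF s A ∨' subF s B
  subF s (A ⇒' B)   = subF s A ⇒' subF s B
  subF s (∀' A)     = ∀' (subF (liftS s) A)
  subF s (∃' A)     = ∃' (subF (liftS s) A)
  subF s (∀∈ t A)   = ∀∈ (subT s t) (subF (liftS s) A)
  subF s (∃∈ t A)   = ∃∈ (subT s t) (subF (liftS s) A)

  single : ∀ {Γ σ} → Tm L Γ σ → Sub (σ ∷ Γ) Γ
  single t ze     = t
  single t (su x) = var x

  _[_] : ∀ {Γ σ} → Fm L (σ ∷ Γ) → Tm L Γ σ → Fm L Γ
  A [ t ] = subF (single t) A

module _ (L : Language) where
  open Language L

  -- The theory IL^ω_* : intuitionistic natural deduction in all types,
  -- plus the axioms (as schemata over arbitrary terms).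
  -- Γ ⊢ under hypotheses Δ : Pf Γ Δ A

  data Pf : (Γ : Ctx) → List (Fm L Γ) → Fm L Γ → Set where
    hyp  : ∀ {Γ Δ A} → A ∈ᴸ Δ → Pf Γ Δ A
    ⊥E   : ∀ {Γ Δ A} → Pf Γ Δ ⊥' → Pf Γ Δ A
    ∧I   : ∀ {Γ Δ A B} → Pf Γ Δ A → Pf Γ Δ B → Pf Γ Δ (A ∧' B)
    ∧E₁  : ∀ {Γ Δ A B} → Pf Γ Δ (A ∧' B) → Pf Γ Δ A
    ∧E₂  : ∀ {Γ Δ A B} → Pf Γ Δ (A ∧' B) → Pf Γ Δ B
    ∨I₁  : ∀ {Γ Δ A B} → Pf Γ Δ A → Pf Γ Δ (A ∨' B)
    ∨I₂  : ∀ {Γ Δ A B} → Pf Γ Δ B → Pf Γ Δ (A ∨' B)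
    ∨E   : ∀ {Γ Δ A B C} → Pf Γ Δ (A ∨' B) → Pf Γ (A ∷ Δ) C
         → Pf Γ (B ∷ Δ) C → Pf Γ Δ C
    ⇒I   : ∀ {Γ Δ A B} → Pf Γ (A ∷ Δ) B → Pf Γ Δ (A ⇒' B)
    ⇒E   : ∀ {Γ Δ A B} → Pf Γ Δ (A ⇒' B) → Pf Γ Δ A → Pf Γ Δ B
    ∀I   : ∀ {Γ Δ σ} {A : Fm L (σ ∷ Γ)} → Pf (σ ∷ Γ) (map wkF Δ) A
         → Pf Γ Δ (∀' A)
    ∀E   : ∀ {Γ Δ σ} {A : Fm L (σ ∷ Γ)} → Pf Γ Δ (∀' A) → (t : Tm L Γ σ)
         → Pf Γ Δ (A [ t ])
    ∃I   : ∀ {Γ Δ σ} {A : Fm L (σ ∷ Γ)} (t : Tm L Γ σ) → Pf Γ Δ (A [ t ])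
         → Pf Γ Δ (∃' A)
    ∃E   : ∀ {Γ Δ σ C} {A : Fm L (σ ∷ Γ)} → Pf Γ Δ (∃' A)
         → Pf (σ ∷ Γ) (A ∷ map wkF Δ) (wkF C) → Pf Γ Δ C
    eq-refl  : ∀ {Γ Δ ρ} (x : Tm L Γ ρ) → Pf Γ Δ (x ≐ x)
    eq-subst : ∀ {Γ Δ ρ} (x y : Tm L Γ ρ) (C : Fm L (ρ ∷ Γ)) → Atomic L C
             → Pf Γ Δ ((x ≐ y) ∧' (C [ x ]) ⇒' (C [ y ]))
    ∀∈-ax : ∀ {Γ Δ ρ} (t : Tm L Γ (ρ *)) (A : Fm L (ρ ∷ Γ))
          → Pf Γ Δ (∀∈ t A ⇔' ∀' (var ze ∈' wkT t ⇒' A))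
    ∃∈-ax : ∀ {Γ Δ ρ} (t : Tm L Γ (ρ *)) (A : Fm L (ρ ∷ Γ))
          → Pf Γ Δ (∃∈ t A ⇔' ∃' (var ze ∈' wkT t ∧' A))
    Σ-ax : ∀ {Γ Δ ρ σ τ} (x : Tm L Γ (ρ ⇒ σ ⇒ τ)) (y : Tm L Γ (ρ ⇒ σ)) (z : Tm L Γ ρ)
         → Pf Γ Δ (Σc · x · y · z ≐ x · z · (y · z))
    Π-ax : ∀ {Γ Δ σ τ} (x : Tm L Γ σ) (y : Tm L Γ τ) → Pf Γ Δ (Πc · x · y ≐ x)
    𝔰-ax : ∀ {Γ Δ σ} (w x : Tm L Γ σ) → Pf Γ Δ (w ∈' 𝔰c · x ⇔' w ≐ x)
    ∪-ax : ∀ {Γ Δ σ} (w : Tm L Γ σ) (x y : Tm L Γ (σ *))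
         → Pf Γ Δ (w ∈' ∪c · x · y ⇔' (w ∈' x) ∨' (w ∈' y))
    ⋃-ax : ∀ {Γ Δ σ τ} (z : Tm L Γ σ) (w : Tm L Γ τ) (x : Tm L Γ (σ *))
             (y : Tm L Γ (σ ⇒ τ *))
         → Pf Γ Δ ((z ∈' x) ∧' (w ∈' y · z) ⇒' w ∈' ⋃c · x · y)
    ⋃𝔰-ax : ∀ {Γ Δ σ τ} (x : Tm L Γ σ) (y : Tm L Γ (σ ⇒ τ *))
          → Pf Γ Δ (⋃c · (𝔰c · x) · y ≐ y · x)
    ⋃∪-ax : ∀ {Γ Δ σ τ} (x y : Tm L Γ (σ *)) (z : Tm L Γ (σ ⇒ τ *))
          → Pf Γ Δ (⋃c · (∪c · x · y) · z ≐ ∪c · (⋃c · x · z) · (⋃c · y · z))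

module _ {L : Language} where
  ⋁ : ∀ {Γ n} → Vec (Fm L Γ) (suc n) → Fm L Γ
  ⋁ (A ∷ᵛ []ᵛ)       = A
  ⋁ (A ∷ᵛ (B ∷ᵛ As)) = A ∨' ⋁ (B ∷ᵛ As)

{-# OPTIONS --safe #-}
module Submission where

-- A Tait-style reducibility argument. Relative to an embedding of closed terms into
-- the context, every term of ground type is reducible, a term of arrow type is
-- reducible when it maps reducible closed arguments to reducible values, and a term
-- of type σ* is reducible when it is provably equal to a finite union of singletons
-- of reducible closed terms. The Π, Σ, 𝔰 and ∪ constants are reducible by their axioms,
-- and ⋃ by induction on the finite union using ⋃𝔰 and ⋃∪, so every closed term is
-- reducible. Membership in a finite union of singletons is then, by the 𝔰 and ∪
-- axioms, the disjunction of the equalities with its elements.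

open import Defs
open import Data.Nat using (ℕ; zero; suc; _+_)
open import Data.List using (List; []; _∷_)
open import Data.List.Relation.Unary.Any using (here)
open import Data.Vec using (Vec; map; _++_) renaming (_∷_ to _∷ᵛ_; [] to []ᵛ)
open import Data.Vec.Properties using (map-++)
open import Data.Product using (Σ; Σ-syntax; _×_; _,_)
open import Data.Unit using (⊤; tt)
open import Relation.Binary.PropositionalEquality using (_≡_; refl; cong; cong₂)

module _ {L : Language} where

  subT-single-wkT : ∀ {Γ σ τ} (x : Tm L Γ σ) (a : Tm L Γ τ) → subT (single x) (wkT a) ≡ a
  subT-single-wkT x (var v) = refl
  subT-single-wkT x (fun f) = refl
  subT-single-wkT x Πc      = refl
  subT-single-wkT x Σc      = refl
  subT-single-wkT x 𝔰c      = refl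
  subT-single-wkT x ∪c      = refl
  subT-single-wkT x ⋃c      = refl
  subT-single-wkT x (a · b) = cong₂ _·_ (subT-single-wkT x a) (subT-single-wkT x b)

module Derivable (L : Language) (Γ : Ctx) where

  infix 4 _⊢_ ⊢_

  _⊢_ : List (Fm L Γ) → Fm L Γ → Set
  Δ ⊢ A = Pf L Γ Δ A

  -- Pf admits no weakening of hypotheses, so derived rules that discharge a hypothesis
  -- (⇔-trans, ∨-cong, ∈-cong) need their premises under arbitrary hypotheses.
  ⊢_ : Fm L Γ → Set
  ⊢ A = ∀ {Δ} → Δ ⊢ A

  ⇔-refl : ∀ {A} → ⊢ A ⇔' A
  ⇔-refl = ∧I (⇒I (hyp (here refl))) (⇒I (hyp (here refl)))

  ⇔-sym : ∀ {A B} → ⊢ A ⇔' B → ⊢ B ⇔' A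
  ⇔-sym p = ∧I (∧E₂ p) (∧E₁ p)

  ⇔-trans : ∀ {A B C} → ⊢ A ⇔' B → ⊢ B ⇔' C → ⊢ A ⇔' C
  ⇔-trans p q = ∧I (⇒I (⇒E (∧E₁ q) (⇒E (∧E₁ p) (hyp (here refl)))))
                   (⇒I (⇒E (∧E₂ p) (⇒E (∧E₂ q) (hyp (here refl)))))

  ∨-mono : ∀ {A B A′ B′} → ⊢ A ⇒' A′ → ⊢ B ⇒' B′ → ⊢ A ∨' B ⇒' A′ ∨' B′
  ∨-mono p q = ⇒I (∨E (hyp (here refl)) (∨I₁ (⇒E p (hyp (here refl))))
                                        (∨I₂ (⇒E q (hyp (here refl)))))

  ∨-cong : ∀ {A B A′ B′} → ⊢ A ⇔' A′ → ⊢ B ⇔' B′ → ⊢ A ∨' B ⇔' A′ ∨' B′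
  ∨-cong p q = ∧I (∨-mono (∧E₁ p) (∧E₁ q)) (∨-mono (∧E₂ p) (∧E₂ q))

  ∨-assoc : ∀ {A B C} → ⊢ (A ∨' B) ∨' C ⇔' A ∨' (B ∨' C)
  ∨-assoc = ∧I (⇒I (∨E (hyp (here refl))
                       (∨E (hyp (here refl)) (∨I₁ (hyp (here refl)))
                                             (∨I₂ (∨I₁ (hyp (here refl)))))
                       (∨I₂ (∨I₂ (hyp (here refl))))))
               (⇒I (∨E (hyp (here refl))
                       (∨I₁ (∨I₁ (hyp (here refl))))
                       (∨E (hyp (here refl)) (∨I₁ (∨I₂ (hyp (here refl))))
                                             (∨I₂ (hyp (here refl))))))

  ⋁-++ : ∀ {m n} (As : Vec (Fm L Γ) (suc m)) (Bs : Vec (Fm L Γ) (suc n))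
       → ⊢ ⋁ (As ++ Bs) ⇔' ⋁ As ∨' ⋁ Bs
  ⋁-++ (A ∷ᵛ []ᵛ)       (B ∷ᵛ Bs) = ⇔-refl
  ⋁-++ (A ∷ᵛ A′ ∷ᵛ As) Bs        =
    ⇔-trans (∨-cong ⇔-refl (⋁-++ (A′ ∷ᵛ As) Bs)) (⇔-sym ∨-assoc)

  ≐-elim : ∀ {Δ ρ} {x y : Tm L Γ ρ} {A B} (C : Fm L (ρ ∷ Γ)) → Atomic L C
         → C [ x ] ≡ A → C [ y ] ≡ B → Δ ⊢ x ≐ y → Δ ⊢ A → Δ ⊢ B
  ≐-elim {x = x} {y} C atomic refl refl p q = ⇒E (eq-subst x y C atomic) (∧I p q)

  ≐-sym : ∀ {Δ ρ} {x y : Tm L Γ ρ} → Δ ⊢ x ≐ y → Δ ⊢ y ≐ x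
  ≐-sym {x = x} {y} p =
    ≐-elim (var ze ≐ wkT x) (at-eq _ _)
           (cong (x ≐_) (subT-single-wkT x x)) (cong (y ≐_) (subT-single-wkT y x))
           p (eq-refl x)

  ≐-trans : ∀ {Δ ρ} {x y z : Tm L Γ ρ} → Δ ⊢ x ≐ y → Δ ⊢ y ≐ z → Δ ⊢ x ≐ z
  ≐-trans {x = x} {y} {z} p q =
    ≐-elim (wkT x ≐ var ze) (at-eq _ _)
           (cong (_≐ y) (subT-single-wkT y x)) (cong (_≐ z) (subT-single-wkT z x))
           q p

  ·-congˡ : ∀ {Δ σ τ} {f g : Tm L Γ (σ ⇒ τ)} (a : Tm L Γ σ) → Δ ⊢ f ≐ g → Δ ⊢ f · a ≐ g · a
  ·-congˡ {f = f} {g} a p =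
    ≐-elim (wkT f · wkT a ≐ var ze · wkT a) (at-eq _ _)
           (cong₂ (λ f′ a′ → f′ · a′ ≐ f · a′) (subT-single-wkT f f) (subT-single-wkT f a))
           (cong₂ (λ f′ a′ → f′ · a′ ≐ g · a′) (subT-single-wkT g f) (subT-single-wkT g a))
           p (eq-refl (f · a))

  ·-congʳ : ∀ {Δ σ τ} (f : Tm L Γ (σ ⇒ τ)) {a b : Tm L Γ σ} → Δ ⊢ a ≐ b → Δ ⊢ f · a ≐ f · b
  ·-congʳ f {a} {b} p =
    ≐-elim (wkT f · wkT a ≐ wkT f · var ze) (at-eq _ _)
           (cong₂ (λ f′ a′ → f′ · a′ ≐ f′ · a) (subT-single-wkT a f) (subT-single-wkT a a))
           (cong₂ (λ f′ a′ → f′ · a′ ≐ f′ · b) (subT-single-wkT b f) (subT-single-wkT b a))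
           p (eq-refl (f · a))

  ·-cong : ∀ {Δ σ τ} {f g : Tm L Γ (σ ⇒ τ)} {a b : Tm L Γ σ}
         → Δ ⊢ f ≐ g → Δ ⊢ a ≐ b → Δ ⊢ f · a ≐ g · b
  ·-cong {g = g} {a} p q = ≐-trans (·-congˡ a p) (·-congʳ g q)

  ∈-cong : ∀ {ρ} (w : Tm L Γ ρ) {a b : Tm L Γ (ρ *)} → ⊢ a ≐ b → ⊢ w ∈' a ⇔' w ∈' b
  ∈-cong w p = ∧I (⇒I (∈-subst p (hyp (here refl))))
                  (⇒I (∈-subst (≐-sym p) (hyp (here refl))))
    where
    ∈-subst : ∀ {Δ x y} → Δ ⊢ x ≐ y → Δ ⊢ w ∈' x → Δ ⊢ w ∈' y
    ∈-subst {x = x} {y} =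
      ≐-elim (wkT w ∈' var ze) (at-mem _ _)
             (cong (_∈' x) (subT-single-wkT x w)) (cong (_∈' y) (subT-single-wkT y w))

module Reducibility (L : Language) (Γ : Ctx) (e : Ren {L = L} [] Γ) where
  open Language L
  open Derivable L Γ

  data FinUnion {σ : Ty} (P : Tm L [] σ → Set) : Tm L Γ (σ *) → Set where
    singleton : (q : Tm L [] σ) → P q → FinUnion P (𝔰c · renT e q)
    union     : ∀ {a b} → FinUnion P a → FinUnion P b → FinUnion P (∪c · a · b)

  Reducible : (σ : Ty) → Tm L Γ σ → Set
  Reducible G       t = ⊤
  Reducible (σ ⇒ τ) t = (q : Tm L [] σ) → Reducible σ (renT e q) → Reducible τ (t · renT e q)
  Reducible (σ *)   t = Σ[ u ∈ Tm L Γ (σ *) ] FinUnion (λ q → Reducible σ (renT e q)) u × ⊢ t ≐ u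

  -- one less than the number of singletons
  size : ∀ {σ} {P} {u : Tm L Γ (σ *)} → FinUnion P u → ℕ
  size (singleton _ _) = zero
  size (union a b)     = size a + suc (size b)

  elements : ∀ {σ} {P} {u : Tm L Γ (σ *)} (c : FinUnion P u) → Vec (Tm L [] σ) (suc (size c))
  elements (singleton q _) = q ∷ᵛ []ᵛ
  elements (union a b)     = elements a ++ elements b

  ∈-FinUnion : ∀ {σ} (w : Tm L Γ σ) {P} {u : Tm L Γ (σ *)} (c : FinUnion P u)
             → ⊢ w ∈' u ⇔' ⋁ (map (λ q → w ≐ renT e q) (elements c))
  ∈-FinUnion w (singleton q _) = 𝔰-ax _ _
  ∈-FinUnion w (union a b) rewrite map-++ (λ q → w ≐ renT e q) (elements a) (elements b) =
    ⇔-trans (∪-ax _ _ _)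
      (⇔-trans (∨-cong (∈-FinUnion w a) (∈-FinUnion w b))
               (⇔-sym (⋁-++ (map (λ q → w ≐ renT e q) (elements a))
                            (map (λ q → w ≐ renT e q) (elements b)))))

  Reducible-resp-≐ : ∀ σ {t t′ : Tm L Γ σ} → ⊢ t ≐ t′ → Reducible σ t′ → Reducible σ t
  Reducible-resp-≐ G       p _              = tt
  Reducible-resp-≐ (σ ⇒ τ) p r q rq         =
    Reducible-resp-≐ τ (·-congˡ (renT e q) p) (r q rq)
  Reducible-resp-≐ (σ *)   p (u , c , t′≐u) = u , c , ≐-trans p t′≐u

  Reducible-arrG : ∀ n (t : Tm L Γ (arrG n)) → Reducible (arrG n) t
  Reducible-arrG zero    t     = tt
  Reducible-arrG (suc n) t q _ = Reducible-arrG n (t · renT e q)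

  Reducible-∪ : ∀ {σ} {a b : Tm L Γ (σ *)}
              → Reducible (σ *) a → Reducible (σ *) b → Reducible (σ *) (∪c · a · b)
  Reducible-∪ (u , c , a≐u) (v , d , b≐v) = ∪c · u · v , union c d , ·-cong (·-congʳ ∪c a≐u) b≐v

  Reducible-⋃ : ∀ {σ τ} {u : Tm L Γ (σ *)} {f : Tm L Γ (σ ⇒ τ *)}
              → FinUnion (λ q → Reducible σ (renT e q)) u → Reducible (σ ⇒ τ *) f
              → Reducible (τ *) (⋃c · u · f)
  Reducible-⋃ (singleton q rq) rf = Reducible-resp-≐ (_ *) (⋃𝔰-ax _ _) (rf q rq)
  Reducible-⋃ (union c d)      rf =
    Reducible-resp-≐ (_ *) (⋃∪-ax _ _ _) (Reducible-∪ (Reducible-⋃ c rf) (Reducible-⋃ d rf))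

  reducible : ∀ {σ} (t : Tm L [] σ) → Reducible σ (renT e t)
  reducible (var ())
  reducible (fun f)                   = Reducible-arrG (arity f) _
  reducible Πc a ra b _               = Reducible-resp-≐ _ (Π-ax _ _) ra
  reducible Σc f rf g rg a ra         = Reducible-resp-≐ _ (Σ-ax _ _ _) (rf a ra (g · a) (rg a ra))
  reducible 𝔰c q rq                   = 𝔰c · renT e q , singleton q rq , eq-refl _
  reducible ∪c a ra b rb              = Reducible-∪ ra rb
  reducible ⋃c a (u , c , a≐u) f rf   =
    Reducible-resp-≐ _ (·-congˡ (renT e f) (·-congʳ ⋃c a≐u)) (Reducible-⋃ c rf)
  reducible (s · t)                   = reducible s t (reducible t)

lemma1 : (L : Language) {ρ : Ty} (t : Tm L [] (ρ *))
    → Σ ℕ λ n → Σ (Vec (Tm L [] ρ) (suc n)) λ qs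
      → Pf L (ρ ∷ []) [] (var ze ∈' wkT t ⇔' ⋁ (map (λ q → var ze ≐ wkT q) qs))
lemma1 L {ρ} t =
  let u , c , t≐u = reducible t
  in size c , elements c , ⇔-trans (∈-cong (var ze) t≐u) (∈-FinUnion (var ze) c)
  where
  open Derivable L (ρ ∷ [])
  open Reducibility L (ρ ∷ []) su
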